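{- Let $s\geq t\geq 1$ be integers. The graph $Q$ has a $K_2^*$-packing with residue $0$ such that for every copy of $K_2^*$ in the packing, its vertex $\tau$ is mapped into the $M$-part of $Q$.
   Context: $Q$ is the graph on disjoint vertex sets $L,M,N$ ($L$-part, $M$-part, $N$-part) with $|L|=s-t$, $|M|=|N|=t$, all edges between $L$ and $M$, a perfect matching between $M$ and $N$, and no other edges. A weighted graph is a pair $(F,w_F)$ with $w_F:V(F)\to\mathbb R_{\geq0}$; an unweighted graph has all weights $1$. $K_2^*$ is the weighted graph with vertices $\sigma,\tau$, edge $\sigma\tau$, $w(\sigma)=\frac1{t(s+t)}$, $w(\tau)=\frac1{s(s+t)}$. A $K_2^*$-packing of a graph $G$ is a collection of copies $(F_i)_{i\in I}$ of $K_2^*$ with graph embeddings $f_i:V(F_i)\to V(G)$ (injective, edge-preserving) such that for every $x\in V(G)$, $\sum_{i: x\in \mathrm{Im}(f_i)} w_{F_i}(f_i^{ -1}(x))\leq 1$. Its residue is $|V(G)|-\sum_{i\in I}\sum_{v\in V(F_i)}w_{F_i}(v)$. -}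

module Defs where

open import Data.Nat as ℕ using (ℕ; zero; suc; _∸_; _<_)
import Data.Nat
open import Data.Fin using (Fin; toℕ) renaming (zero to fzero; suc to fsuc)
open import Data.Integer using (+_)
open import Data.Rational using (ℚ; 0ℚ; 1ℚ; _/_; _+_; _-_; _≤_)
open import Data.List using (List; foldr)
open import Data.Product using (_×_)
open import Relation.Binary.PropositionalEquality using (_≡_)
open import Relation.Nullary using (yes; no)
open import Data.Fin using (_≟_)
open import Function.Definitions using (Injective)

record Graph : Set₁ where
  field
    n   : ℕ
    Adj : Fin n → Fin n → Set

record WGraph : Set₁ where
  field
    k   : ℕ
    Adj : Fin k → Fin k → Set
    w   : Fin k → ℚ

record Embedding (F : WGraph) (G : Graph) : Set where
  field
    f   : Fin (WGraph.k F) → Fin (Graph.n G)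
    inj : Injective _≡_ _≡_ f
    hom : ∀ u v → WGraph.Adj F u v → Graph.Adj G (f u) (f v)

sumFin : (k : ℕ) → (Fin k → ℚ) → ℚ
sumFin zero    g = 0ℚ
sumFin (suc k) g = g fzero + sumFin k (λ i → g (fsuc i))

totalWeight : WGraph → ℚ
totalWeight F = sumFin (WGraph.k F) (WGraph.w F)

-- the weight that a copy (F, f) puts on vertex x of G,
-- i.e. w_F(f⁻¹(x)) if x ∈ Im f, and 0 otherwise (f is injective)
weightAt : {F : WGraph} {G : Graph} → Embedding F G → Fin (Graph.n G) → ℚ
weightAt {F} e x = sumFin (WGraph.k F) λ v → pick (Embedding.f e v ≟ x) (WGraph.w F v)
  where
    pick : ∀ {A : Set} {a b : A} → Relation.Nullary.Dec (a ≡ b) → ℚ → ℚ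
    pick (yes _) q = q
    pick (no _)  q = 0ℚ

load : {F : WGraph} {G : Graph} → List (Embedding F G) → Fin (Graph.n G) → ℚ
load cs x = foldr (λ e acc → weightAt e x + acc) 0ℚ cs

record Packing (F : WGraph) (G : Graph) : Set where
  field
    copies : List (Embedding F G)
    valid  : ∀ x → load copies x ≤ 1ℚ

residue : {F : WGraph} {G : Graph} → Packing F G → ℚ
residue {F} {G} P =
  (+ Graph.n G / 1) - foldr (λ _ acc → totalWeight F + acc) 0ℚ (Packing.copies P)

-- 1/m for m ≥ 1 (and 0 for m = 0; only used with m ≥ 1)
inv : ℕ → ℚ
inv zero    = 0ℚ
inv (suc m) = + 1 / suc m

σ τ : Fin 2
σ = fzero
τ = fsuc fzero

data K2Adj : Fin 2 → Fin 2 → Set where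
  στ : K2Adj σ τ
  τσ : K2Adj τ σ

K2w : ℕ → ℕ → Fin 2 → ℚ
K2w s t fzero        = inv (t Data.Nat.* (s Data.Nat.+ t))
K2w s t (fsuc fzero) = inv (s Data.Nat.* (s Data.Nat.+ t))

K2* : ℕ → ℕ → WGraph
K2* s t = record { k = 2 ; Adj = K2Adj ; w = K2w s t }

-- The graph Q
-- Vertices are Fin ((s ∸ t) + t + t), with
--   L = {0, …, s−t−1},  M = {s−t, …, s−1},  N = {s, …, s+t−1},
-- and the matching pairs the vertex s−t+j of M with the vertex s+j of N.

Qn : ℕ → ℕ → ℕ
Qn s t = (s ∸ t) Data.Nat.+ t Data.Nat.+ t

inL : (s t : ℕ) → Fin (Qn s t) → Set
inL s t x = toℕ x < s ∸ t

inM : (s t : ℕ) → Fin (Qn s t) → Set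
inM s t x = (s ∸ t) Data.Nat.≤ toℕ x × toℕ x < (s ∸ t) Data.Nat.+ t

inN : (s t : ℕ) → Fin (Qn s t) → Set
inN s t x = (s ∸ t) Data.Nat.+ t Data.Nat.≤ toℕ x

data QAdj (s t : ℕ) (x y : Fin (Qn s t)) : Set where
  LM : inL s t x → inM s t y → QAdj s t x y
  ML : inM s t x → inL s t y → QAdj s t x y
  MN : inM s t x → toℕ y ≡ toℕ x Data.Nat.+ t → QAdj s t x y
  NM : inM s t y → toℕ x ≡ toℕ y Data.Nat.+ t → QAdj s t x y

Q : ℕ → ℕ → Graph
Q s t = record { n = Qn s t ; Adj = QAdj s t }

-- Use every matching edge MₘNₘ with multiplicity t(s+t) and every L–M edge with multiplicity
-- s+t, always with τ on the M-side.  A vertex of N then receives t(s+t)·w(σ) = 1, a vertex of L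
-- receives t·(s+t)·w(σ) = 1 from its t neighbours, and a vertex of M receives
-- (t(s+t) + (s−t)(s+t))·w(τ) = s(s+t)·w(τ) = 1.  A packing loading every vertex with exactly 1
-- has residue 0 by double counting: its total weight is Σₓ load(x) = |V(Q)|.
module Submission where

open import Algebra.Bundles using (Semiring; CommutativeRing)
open import Data.Bool using (if_then_else_)
open import Data.Fin using (Fin; toℕ; _↑ˡ_; _↑ʳ_; _≟_) renaming (zero to fzero; suc to fsuc)
open import Data.Fin.Properties using (toℕ-↑ˡ; toℕ-↑ʳ; toℕ<n)
open import Data.Integer as ℤ using ()
import Data.Integer.Properties as ℤP
open import Data.List using (List; []; _∷_; _++_; replicate; concat; tabulate; foldr)
open import Data.List.Relation.Unary.All using (All)
open import Data.List.Relation.Unary.All.Properties using (++⁺; concat⁺; tabulate⁺; replicate⁺)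
open import Data.Nat as ℕ using (ℕ; zero; suc; NonZero; >-nonZero; _∸_; _≤_; _<_)
import Data.Nat.Properties as ℕP
open import Data.Nat.Coprimality using (1-coprimeTo) renaming (sym to coprime-sym)
open import Data.Product using (Σ-syntax; _×_; _,_; proj₁)
open import Data.Rational using (ℚ; mkℚ; 0ℚ; 1ℚ; _/_; _+_; _*_; _-_)
open import Data.Rational.Properties
  using (+-*-commutativeRing; /-cong; ↥p/↧p≡p; normalize-coprime; *-inverseʳ;
         +-identityˡ; +-identityʳ; +-assoc; *-assoc; *-identityˡ; *-identityʳ; *-zeroˡ; +-inverseʳ; ≤-reflexive)
open import Data.Rational.Solver using (module +-*-Solver)
open import Function using (_∘_)
open import Level using (0ℓ)
open import Relation.Binary.PropositionalEquality
open import Relation.Nullary using (does; yes; no)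
open import Data.Empty using (⊥-elim)
open import Defs

open +-*-Solver using (solve; _:+_; _:*_; _:=_; con)

ℚ-semiring : Semiring 0ℓ 0ℓ
ℚ-semiring = CommutativeRing.semiring +-*-commutativeRing

open import Algebra.Properties.Semiring.Sum ℚ-semiring
  using (sum-syntax; ∑-distrib-+; sum-cong-≗; sum-replicate-zero; *-distribʳ-sum)
open import Algebra.Properties.Semiring.Mult ℚ-semiring
  using (×-homo-+; ×1-homo-*) renaming (_×_ to _×ℚ_)

ι : ℕ → ℚ
ι n = n ×ℚ 1ℚ

ι≡mkℚ : ∀ n → ι n ≡ mkℚ (ℤ.+ n) 0 (coprime-sym (1-coprimeTo n))
ι≡mkℚ zero    = refl
ι≡mkℚ (suc n) = begin
  1ℚ + ι n                                           ≡⟨ cong (1ℚ +_) (ι≡mkℚ n) ⟩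
  1ℚ + mkℚ (ℤ.+ n) 0 (coprime-sym (1-coprimeTo n))  ≡⟨ /-cong (cong (ℤ._+_ ℤ.1ℤ) (ℤP.*-identityʳ (ℤ.+ n))) refl ⟩
  ℤ.+ suc n / 1                                      ≡⟨ ↥p/↧p≡p _ ⟩
  mkℚ (ℤ.+ suc n) 0 _                                ∎
  where open ≡-Reasoning

ι≡/1 : ∀ n → ι n ≡ ℤ.+ n / 1
ι≡/1 n = trans (ι≡mkℚ n) (sym (↥p/↧p≡p _))

ι-*-inv : ∀ k .{{_ : NonZero k}} → ι k * inv k ≡ 1ℚ
ι-*-inv (suc k) =
  trans (cong₂ _*_ (ι≡mkℚ (suc k)) (normalize-coprime (1-coprimeTo (suc k))))
        (*-inverseʳ (mkℚ (ℤ.+ suc k) 0 (coprime-sym (1-coprimeTo (suc k)))))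

sumFin≡∑ : ∀ k (g : Fin k → ℚ) → sumFin k g ≡ ∑[ i < k ] g i
sumFin≡∑ zero    g = refl
sumFin≡∑ (suc k) g = cong (g fzero +_) (sumFin≡∑ k (g ∘ fsuc))

∑-const : ∀ n q → ∑[ i < n ] q ≡ ι n * q
∑-const zero    q = sym (*-zeroˡ q)
∑-const (suc n) q = begin
  q + ∑[ i < n ] q     ≡⟨ cong (q +_) (∑-const n q) ⟩
  q + ι n * q          ≡⟨ solve 2 (λ q w → q :+ w :* q := (con 1ℚ :+ w) :* q) refl q (ι n) ⟩
  (1ℚ + ι n) * q       ∎
  where open ≡-Reasoning

∑-+-const : ∀ n (x : Fin n → ℚ) q → ∑[ i < n ] (x i + q) ≡ ∑[ i < n ] x i + ι n * q
∑-+-const n x q = trans (∑-distrib-+ x (λ _ → q)) (cong (∑[ i < n ] x i +_) (∑-const n q))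

∑-↑ : ∀ m n (f : Fin (m ℕ.+ n) → ℚ) →
      ∑[ i < m ℕ.+ n ] f i ≡ ∑[ i < m ] f (i ↑ˡ n) + ∑[ j < n ] f (m ↑ʳ j)
∑-↑ zero    n f = sym (+-identityˡ _)
∑-↑ (suc m) n f = trans (cong (f fzero +_) (∑-↑ m n (f ∘ fsuc))) (sym (+-assoc (f fzero) _ _))

-- Through `does`, δ (suc x) (suc y) reduces to δ x y.
δ : ∀ {n} → Fin n → Fin n → ℚ
δ x y = if does (x ≟ y) then 1ℚ else 0ℚ

δ-comm : ∀ {n} (x y : Fin n) → δ x y ≡ δ y x
δ-comm fzero    fzero    = refl
δ-comm fzero    (fsuc y) = refl
δ-comm (fsuc x) fzero    = refl
δ-comm (fsuc x) (fsuc y) = δ-comm x y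

∑-δ : ∀ {n} (y : Fin n) → ∑[ x < n ] δ x y ≡ 1ℚ
∑-δ {suc n} fzero    = trans (cong (1ℚ +_) (sum-replicate-zero n)) (+-identityʳ 1ℚ)
∑-δ {suc n} (fsuc y) = trans (+-identityˡ _) (∑-δ y)

module _ {F : WGraph} {G : Graph} where

  load-++ : ∀ (xs ys : List (Embedding F G)) x → load (xs ++ ys) x ≡ load xs x + load ys x
  load-++ []       ys x = sym (+-identityˡ _)
  load-++ (e ∷ xs) ys x = trans (cong (weightAt e x +_) (load-++ xs ys x)) (sym (+-assoc (weightAt e x) _ _))

  load-replicate : ∀ k (e : Embedding F G) x → load (replicate k e) x ≡ ι k * weightAt e x
  load-replicate zero    e x = sym (*-zeroˡ (weightAt e x))
  load-replicate (suc k) e x = begin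
    weightAt e x + load (replicate k e) x  ≡⟨ cong (weightAt e x +_) (load-replicate k e x) ⟩
    weightAt e x + ι k * weightAt e x      ≡⟨ solve 2 (λ w k → w :+ k :* w := (con 1ℚ :+ k) :* w) refl (weightAt e x) (ι k) ⟩
    (1ℚ + ι k) * weightAt e x              ∎
    where open ≡-Reasoning

  load-concat-tabulate : ∀ k (g : Fin k → List (Embedding F G)) x →
                         load (concat (tabulate g)) x ≡ ∑[ i < k ] load (g i) x
  load-concat-tabulate zero    g x = refl
  load-concat-tabulate (suc k) g x =
    trans (load-++ (g fzero) _ x) (cong (load (g fzero) x +_) (load-concat-tabulate k (g ∘ fsuc) x))

module _ {s t : ℕ} {G : Graph} where

  private
    V : Set
    V = Fin (Graph.n G)
    E : Set
    E = Embedding (K2* s t) G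
    f : E → Fin 2 → V
    f = Embedding.f
    a b : ℚ
    a = K2w s t σ
    b = K2w s t τ

  K2*-copy : (x y : V) → x ≢ y → Graph.Adj G x y → Graph.Adj G y x → E
  K2*-copy x y x≢y xy yx = record { f = image ; inj = injective ; hom = edge }
    where
    image : Fin 2 → V
    image fzero        = x
    image (fsuc fzero) = y
    injective : ∀ {u v} → image u ≡ image v → u ≡ v
    injective {fzero}        {fzero}        _  = refl
    injective {fzero}        {fsuc fzero}   eq = ⊥-elim (x≢y eq)
    injective {fsuc fzero}   {fzero}        eq = ⊥-elim (x≢y (sym eq))
    injective {fsuc fzero}   {fsuc fzero}   _  = refl
    edge : ∀ u v → K2Adj u v → Graph.Adj G (image u) (image v)
    edge _ _ στ = xy
    edge _ _ τσ = yx

  weightAt-K2* : (e : E) (x : V) → weightAt e x ≡ δ (f e σ) x * a + δ (f e τ) x * b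
  weightAt-K2* e x with f e σ ≟ x | f e τ ≟ x
  ... | yes _ | yes _ = cong₂ _+_ (sym (*-identityˡ a)) (trans (+-identityʳ b) (sym (*-identityˡ b)))
  ... | yes _ | no _  = cong₂ _+_ (sym (*-identityˡ a)) (trans (+-identityʳ 0ℚ) (sym (*-zeroˡ b)))
  ... | no _  | yes _ = cong₂ _+_ (sym (*-zeroˡ a)) (trans (+-identityʳ b) (sym (*-identityˡ b)))
  ... | no _  | no _  = cong₂ _+_ (sym (*-zeroˡ a)) (trans (+-identityʳ 0ℚ) (sym (*-zeroˡ b)))

  ∑-weightAt : (e : E) → ∑[ x < Graph.n G ] weightAt e x ≡ totalWeight (K2* s t)
  ∑-weightAt e = begin
    ∑[ x < n ] weightAt e x                                       ≡⟨ sum-cong-≗ (weightAt-K2* e) ⟩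
    ∑[ x < n ] (δ (f e σ) x * a + δ (f e τ) x * b)                ≡⟨ ∑-distrib-+ (λ x → δ (f e σ) x * a) (λ x → δ (f e τ) x * b) ⟩
    ∑[ x < n ] (δ (f e σ) x * a) + ∑[ x < n ] (δ (f e τ) x * b)   ≡⟨ cong₂ _+_ (sym (*-distribʳ-sum a (λ x → δ (f e σ) x))) (sym (*-distribʳ-sum b (λ x → δ (f e τ) x))) ⟩
    (∑[ x < n ] δ (f e σ) x) * a + (∑[ x < n ] δ (f e τ) x) * b   ≡⟨ cong₂ _+_ (cong (_* a) (∑-δ′ (f e σ))) (cong (_* b) (∑-δ′ (f e τ))) ⟩
    1ℚ * a + 1ℚ * b                                               ≡⟨ cong₂ _+_ (*-identityˡ a) (trans (*-identityˡ b) (sym (+-identityʳ b))) ⟩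
    a + (b + 0ℚ)                                                  ≡⟨ sym (sumFin≡∑ 2 (K2w s t)) ⟩
    totalWeight (K2* s t)                                         ∎
    where
    open ≡-Reasoning
    n : ℕ
    n = Graph.n G
    ∑-δ′ : (y : V) → ∑[ x < n ] δ y x ≡ 1ℚ
    ∑-δ′ y = trans (sum-cong-≗ (δ-comm y)) (∑-δ y)

  ∑-load : (cs : List E) → ∑[ x < Graph.n G ] load cs x ≡ foldr (λ _ acc → totalWeight (K2* s t) + acc) 0ℚ cs
  ∑-load []       = sum-replicate-zero (Graph.n G)
  ∑-load (e ∷ cs) = trans (∑-distrib-+ (weightAt e) (load cs)) (cong₂ _+_ (∑-weightAt e) (∑-load cs))

  residue≡0 : (P : Packing (K2* s t) G) → (∀ x → load (Packing.copies P) x ≡ 1ℚ) → residue P ≡ 0ℚ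
  residue≡0 P load≡1 = begin
    ℤ.+ n / 1 - foldr (λ _ acc → totalWeight (K2* s t) + acc) 0ℚ cs  ≡⟨ cong₂ _-_ (sym (ι≡/1 n)) (sym (∑-load cs)) ⟩
    ι n - ∑[ x < n ] load cs x                                       ≡⟨ cong (ι n -_) (trans (sum-cong-≗ load≡1) (∑-const n 1ℚ)) ⟩
    ι n - ι n * 1ℚ                                                   ≡⟨ cong (ι n -_) (*-identityʳ (ι n)) ⟩
    ι n - ι n                                                        ≡⟨ +-inverseʳ (ι n) ⟩
    0ℚ                                                               ∎
    where
    open ≡-Reasoning
    n : ℕ
    n = Graph.n G
    cs : List E
    cs = Packing.copies P

module PackingOfQ (s t : ℕ) (1≤t : 1 ≤ t) (t≤s : t ≤ s) where

  d : ℕ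
  d = s ∸ t
  V : Set
  V = Fin (Qn s t)
  E : Set
  E = Embedding (K2* s t) (Q s t)
  a b : ℚ
  a = K2w s t σ
  b = K2w s t τ

  Lv : Fin d → V
  Lv l = (l ↑ˡ t) ↑ˡ t
  Mv : Fin t → V
  Mv m = (d ↑ʳ m) ↑ˡ t
  Nv : Fin t → V
  Nv m = (d ℕ.+ t) ↑ʳ m

  toℕ-Lv : ∀ l → toℕ (Lv l) ≡ toℕ l
  toℕ-Lv l = trans (toℕ-↑ˡ (l ↑ˡ t) t) (toℕ-↑ˡ l t)

  toℕ-Mv : ∀ m → toℕ (Mv m) ≡ d ℕ.+ toℕ m
  toℕ-Mv m = trans (toℕ-↑ˡ (d ↑ʳ m) t) (toℕ-↑ʳ d m)

  toℕ-Nv : ∀ m → toℕ (Nv m) ≡ toℕ (Mv m) ℕ.+ t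
  toℕ-Nv m = begin
    toℕ (Nv m)            ≡⟨ toℕ-↑ʳ (d ℕ.+ t) m ⟩
    d ℕ.+ t ℕ.+ toℕ m     ≡⟨ ℕP.+-assoc d t (toℕ m) ⟩
    d ℕ.+ (t ℕ.+ toℕ m)   ≡⟨ cong (d ℕ.+_) (ℕP.+-comm t (toℕ m)) ⟩
    d ℕ.+ (toℕ m ℕ.+ t)   ≡⟨ sym (ℕP.+-assoc d (toℕ m) t) ⟩
    d ℕ.+ toℕ m ℕ.+ t     ≡⟨ cong (ℕ._+ t) (sym (toℕ-Mv m)) ⟩
    toℕ (Mv m) ℕ.+ t      ∎
    where open ≡-Reasoning

  Lv∈L : ∀ l → inL s t (Lv l)
  Lv∈L l = subst (ℕ._< d) (sym (toℕ-Lv l)) (toℕ<n l)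

  Mv∈M : ∀ m → inM s t (Mv m)
  Mv∈M m = subst (d ≤_) (sym (toℕ-Mv m)) (ℕP.m≤m+n d (toℕ m))
         , subst (ℕ._< d ℕ.+ t) (sym (toℕ-Mv m)) (ℕP.+-monoʳ-< d (toℕ<n m))

  Lv≢Mv : ∀ l m → Lv l ≢ Mv m
  Lv≢Mv l m = ℕP.<⇒≢ (ℕP.<-≤-trans (Lv∈L l) (proj₁ (Mv∈M m))) ∘ cong toℕ

  Nv≢Mv : ∀ m → Nv m ≢ Mv m
  Nv≢Mv m = ℕP.>⇒≢ (subst (toℕ (Mv m) <_) (sym (toℕ-Nv m)) (ℕP.m<m+n (toℕ (Mv m)) 1≤t)) ∘ cong toℕ

  matchingCopy : ∀ m → E
  matchingCopy m = K2*-copy (Nv m) (Mv m) (Nv≢Mv m) (NM (Mv∈M m) (toℕ-Nv m)) (MN (Mv∈M m) (toℕ-Nv m))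

  bipartiteCopy : Fin d → Fin t → E
  bipartiteCopy l m = K2*-copy (Lv l) (Mv m) (Lv≢Mv l m) (LM (Lv∈L l) (Mv∈M m)) (ML (Mv∈M m) (Lv∈L l))

  partition : ∀ z → ∑[ l < d ] δ (Lv l) z + ∑[ m < t ] δ (Mv m) z + ∑[ m < t ] δ (Nv m) z ≡ 1ℚ
  partition z = begin
    ∑[ l < d ] δ (Lv l) z + ∑[ m < t ] δ (Mv m) z + ∑[ m < t ] δ (Nv m) z
      ≡⟨ cong (_+ ∑[ m < t ] δ (Nv m) z) (∑-↑ d t (λ y → δ (y ↑ˡ t) z)) ⟨
    ∑[ y < d ℕ.+ t ] δ (y ↑ˡ t) z + ∑[ m < t ] δ (Nv m) z
      ≡⟨ ∑-↑ (d ℕ.+ t) t (λ x → δ x z) ⟨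
    ∑[ x < Qn s t ] δ x z
      ≡⟨ ∑-δ z ⟩
    1ℚ ∎
    where open ≡-Reasoning

  K₁ K₂ : ℕ
  K₂ = s ℕ.+ t
  K₁ = t ℕ.* K₂

  block : Fin t → List E
  block m = replicate K₁ (matchingCopy m) ++ concat (tabulate λ l → replicate K₂ (bipartiteCopy l m))

  copies : List E
  copies = concat (tabulate block)

  instance
    t≢0 : NonZero t
    t≢0 = >-nonZero 1≤t
    s≢0 : NonZero s
    s≢0 = >-nonZero (ℕP.<-≤-trans 1≤t t≤s)
    K₂≢0 : NonZero K₂
    K₂≢0 = >-nonZero (ℕP.<-≤-trans 1≤t (ℕP.m≤n+m t s))

  K₁*a : ι K₁ * a ≡ 1ℚ
  K₁*a = ι-*-inv K₁ {{ℕP.m*n≢0 t K₂}}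

  t*K₂*a : ι t * (ι K₂ * a) ≡ 1ℚ
  t*K₂*a = trans (sym (*-assoc (ι t) (ι K₂) a)) (trans (cong (_* a) (sym (×1-homo-* t K₂))) K₁*a)

  M-degree*b : (ι K₁ + ι d * ι K₂) * b ≡ 1ℚ
  M-degree*b = begin
    (ι K₁ + ι d * ι K₂) * b   ≡⟨ cong (λ q → (ι K₁ + q) * b) (sym (×1-homo-* d K₂)) ⟩
    (ι K₁ + ι (d ℕ.* K₂)) * b ≡⟨ cong (_* b) (sym (×-homo-+ 1ℚ K₁ (d ℕ.* K₂))) ⟩
    ι (K₁ ℕ.+ d ℕ.* K₂) * b   ≡⟨ cong (λ n → ι n * b) degree ⟩
    ι (s ℕ.* K₂) * b          ≡⟨ ι-*-inv (s ℕ.* K₂) {{ℕP.m*n≢0 s K₂}} ⟩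
    1ℚ                        ∎
    where
    open ≡-Reasoning
    degree : K₁ ℕ.+ d ℕ.* K₂ ≡ s ℕ.* K₂
    degree = trans (sym (ℕP.*-distribʳ-+ K₂ t d)) (cong (ℕ._* K₂) (trans (ℕP.+-comm t d) (ℕP.m∸n+n≡m t≤s)))

  load-block : ∀ m z → load (block m) z ≡ δ (Nv m) z + δ (Mv m) z + (∑[ l < d ] δ (Lv l) z) * (ι K₂ * a)
  load-block m z = begin
    load (block m) z
      ≡⟨ load-++ (replicate K₁ (matchingCopy m)) _ z ⟩
    load (replicate K₁ (matchingCopy m)) z + load (concat (tabulate λ l → replicate K₂ (bipartiteCopy l m))) z
      ≡⟨ cong₂ _+_ (load-replicate K₁ (matchingCopy m) z) (load-concat-tabulate d _ z) ⟩
    ι K₁ * weightAt (matchingCopy m) z + ∑[ l < d ] load (replicate K₂ (bipartiteCopy l m)) z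
      ≡⟨ cong₂ _+_ (cong (ι K₁ *_) (weightAt-K2* (matchingCopy m) z)) (sum-cong-≗ bipartiteCopy-load) ⟩
    ι K₁ * (ν * a + μ * b) + ∑[ l < d ] (ℓ l * (ι K₂ * a) + ι K₂ * (μ * b))
      ≡⟨ cong (ι K₁ * (ν * a + μ * b) +_) (∑-+-const d (λ l → ℓ l * (ι K₂ * a)) _) ⟩
    ι K₁ * (ν * a + μ * b) + (∑[ l < d ] (ℓ l * (ι K₂ * a)) + ι d * (ι K₂ * (μ * b)))
      ≡⟨ cong (λ q → ι K₁ * (ν * a + μ * b) + (q + ι d * (ι K₂ * (μ * b)))) (sym (*-distribʳ-sum (ι K₂ * a) ℓ)) ⟩
    ι K₁ * (ν * a + μ * b) + (Λ * (ι K₂ * a) + ι d * (ι K₂ * (μ * b)))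
      ≡⟨ solve 8 (λ k₁ k₂ dd a b ν μ Λ →
                   k₁ :* (ν :* a :+ μ :* b) :+ (Λ :* (k₂ :* a) :+ dd :* (k₂ :* (μ :* b)))
                := ν :* (k₁ :* a) :+ μ :* ((k₁ :+ dd :* k₂) :* b) :+ Λ :* (k₂ :* a))
               refl (ι K₁) (ι K₂) (ι d) a b ν μ Λ ⟩
    ν * (ι K₁ * a) + μ * ((ι K₁ + ι d * ι K₂) * b) + Λ * (ι K₂ * a)
      ≡⟨ cong₂ (λ p q → ν * p + μ * q + Λ * (ι K₂ * a)) K₁*a M-degree*b ⟩
    ν * 1ℚ + μ * 1ℚ + Λ * (ι K₂ * a)
      ≡⟨ cong₂ (λ p q → p + q + Λ * (ι K₂ * a)) (*-identityʳ ν) (*-identityʳ μ) ⟩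
    ν + μ + Λ * (ι K₂ * a) ∎
    where
    open ≡-Reasoning
    ν μ Λ : ℚ
    ν = δ (Nv m) z
    μ = δ (Mv m) z
    ℓ : Fin d → ℚ
    ℓ l = δ (Lv l) z
    Λ = ∑[ l < d ] ℓ l
    bipartiteCopy-load : ∀ l → load (replicate K₂ (bipartiteCopy l m)) z ≡ ℓ l * (ι K₂ * a) + ι K₂ * (μ * b)
    bipartiteCopy-load l = begin
      load (replicate K₂ (bipartiteCopy l m)) z  ≡⟨ load-replicate K₂ (bipartiteCopy l m) z ⟩
      ι K₂ * weightAt (bipartiteCopy l m) z      ≡⟨ cong (ι K₂ *_) (weightAt-K2* (bipartiteCopy l m) z) ⟩
      ι K₂ * (ℓ l * a + μ * b)                   ≡⟨ solve 5 (λ k ℓ a μ b → k :* (ℓ :* a :+ μ :* b) := ℓ :* (k :* a) :+ k :* (μ :* b)) refl (ι K₂) (ℓ l) a μ b ⟩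
      ℓ l * (ι K₂ * a) + ι K₂ * (μ * b)          ∎

  load-copies : ∀ z → load copies z ≡ 1ℚ
  load-copies z = begin
    load copies z                                         ≡⟨ load-concat-tabulate t block z ⟩
    ∑[ m < t ] load (block m) z                           ≡⟨ sum-cong-≗ (λ m → load-block m z) ⟩
    ∑[ m < t ] (ν m + μ m + Λ * c)                        ≡⟨ ∑-+-const t (λ m → ν m + μ m) (Λ * c) ⟩
    ∑[ m < t ] (ν m + μ m) + ι t * (Λ * c)                ≡⟨ cong₂ _+_ (∑-distrib-+ ν μ) (solve 3 (λ k Λ c → k :* (Λ :* c) := Λ :* (k :* c)) refl (ι t) Λ c) ⟩
    ∑[ m < t ] ν m + ∑[ m < t ] μ m + Λ * (ι t * c)       ≡⟨ cong (λ q → ∑[ m < t ] ν m + ∑[ m < t ] μ m + Λ * q) t*K₂*a ⟩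
    ∑[ m < t ] ν m + ∑[ m < t ] μ m + Λ * 1ℚ              ≡⟨ solve 3 (λ N M L → N :+ M :+ L :* con 1ℚ := L :+ M :+ N) refl (∑[ m < t ] ν m) (∑[ m < t ] μ m) Λ ⟩
    Λ + ∑[ m < t ] μ m + ∑[ m < t ] ν m                   ≡⟨ partition z ⟩
    1ℚ                                                    ∎
    where
    open ≡-Reasoning
    ν μ : Fin t → ℚ
    ν m = δ (Nv m) z
    μ m = δ (Mv m) z
    Λ c : ℚ
    Λ = ∑[ l < d ] δ (Lv l) z
    c = ι K₂ * a

  packing : Packing (K2* s t) (Q s t)
  packing = record { copies = copies ; valid = ≤-reflexive ∘ load-copies }

  τ∈M : All (λ e → inM s t (Embedding.f e τ)) copies
  τ∈M = concat⁺ (tabulate⁺ λ m →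
          ++⁺ (replicate⁺ K₁ (Mv∈M m)) (concat⁺ (tabulate⁺ {f = λ l → replicate K₂ (bipartiteCopy l m)} λ l → replicate⁺ K₂ (Mv∈M m))))

lemma8p4 : (s t : ℕ) → 1 ≤ t → t ≤ s →
    Σ[ P ∈ Packing (K2* s t) (Q s t) ]
    (residue P ≡ 0ℚ
    × All (λ e → inM s t (Embedding.f e τ)) (Packing.copies P))
lemma8p4 s t 1≤t t≤s = packing , residue≡0 packing load-copies , τ∈M
  where open PackingOfQ s t 1≤t t≤s
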